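{- Let $n\ge 1$ be an integer and let $\mathcal F$ be an outward pointing field of arrows on the Aztec diamond $A_{n+1}$ (as defined in the context). Let $r$ be the number of repelling interior nodes and $a$ the number of attracting interior nodes of $\mathcal F$. Then $r-a=n+1$.
   Context: For an integer $m\ge 1$, the Aztec diamond of order $m$ is $A_m=\bigcup\{Q : Q\cap\{(x,y): |x|+|y|<m\}\neq\emptyset\}$, where $Q$ ranges over the closed unit squares $[k,k+1]\times[l,l+1]$, $k,l\in\mathbb Z$. Fix $n\ge1$. A node is a lattice point $(i,j)\in A_{n+1}$ with $i+j\equiv n \pmod 2$; nodes lying in $A_n$ are called interior nodes. A lattice square is a closed unit square with integer-coordinate corners contained in $A_{n+1}$; a boundary square is a lattice square contained in $A_{n+1}$ but not in $A_n$. Each lattice square has exactly two (diagonally opposite) corners that are nodes, each interior node is a corner of exactly four lattice squares, and for a boundary square exactly one of its two node corners is an interior node. Suppose in each lattice square one draws an arrow along the diagonal pointing from one of its node corners to the other. This collection is a field of arrows on $A_{n+1}$ if every interior node $N$ is either attracting (all four adjacent arrows point towards $N$), repelling (all four adjacent arrows point away from $N$), or transient (any two collinear arrows adjacent to $N$, i.e. the arrows in the two pairs of squares meeting only at $N$, point in the same direction). A field of arrows is outward pointing if every arrow in a boundary square points towards its non-interior node corner (away from $A_n$). -}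

module Defs where

open import Data.Nat as ℕ using (ℕ; zero; suc)
open import Data.Nat.DivMod using (_%_)
open import Data.Integer as ℤ using (ℤ; +_; -[1+_]; _+_; _-_; ∣_∣; 1ℤ)
open import Data.Integer.Properties using () renaming (_≟_ to _≟ℤ_)
open import Data.Product using (_×_; _,_; proj₁; proj₂)
open import Data.Product.Properties using (≡-dec)
open import Data.Sum using (_⊎_)
open import Data.Bool using (Bool; true; false; if_then_else_)
open import Data.List using (List; map; upTo; cartesianProduct; filter; length)
open import Relation.Binary.PropositionalEquality using (_≡_)
open import Relation.Nullary using (¬_; Dec; yes; no)
open import Relation.Nullary.Decidable using (_×-dec_; _⊎-dec_; ¬?)

Point : Set
Point = ℤ × ℤ

-- The lattice square [k,k+1]×[l,l+1] is represented by its lower-left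
-- corner (k , l).
Square : Set
Square = ℤ × ℤ

-- min { |x| : x ∈ [k,k+1] }  (k ≥ 0 ↦ k ;  k = -(t+1) ↦ t).
minAbs : ℤ → ℕ
minAbs (+ k)    = k
minAbs -[1+ k ] = k

-- The square Q = [k,k+1]×[l,l+1] meets the open set {|x|+|y| < m}
-- iff min_{Q}(|x|+|y|) < m, i.e. iff Q is one of the squares making up A_m.
SquareIn : ℕ → Square → Set
SquareIn m (k , l) = minAbs k ℕ.+ minAbs l ℕ.< m

squareIn? : ∀ m s → Dec (SquareIn m s)
squareIn? m (k , l) = (minAbs k ℕ.+ minAbs l) ℕ.<? m

-- A lattice point lies in A_m iff it is a corner of one of the (four)
-- lattice squares having it as a corner that belong to A_m.
PointIn : ℕ → Point → Set
PointIn m (i , j) =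
  SquareIn m (i - 1ℤ , j - 1ℤ) ⊎ SquareIn m (i - 1ℤ , j) ⊎
  SquareIn m (i , j - 1ℤ) ⊎ SquareIn m (i , j)

pointIn? : ∀ m p → Dec (PointIn m p)
pointIn? m (i , j) =
  squareIn? m (i - 1ℤ , j - 1ℤ) ⊎-dec squareIn? m (i - 1ℤ , j) ⊎-dec
  squareIn? m (i , j - 1ℤ) ⊎-dec squareIn? m (i , j)

NodeParity : ℕ → Point → Set
NodeParity n (i , j) = ∣ i + j - + n ∣ % 2 ≡ 0

nodeParity? : ∀ n p → Dec (NodeParity n p)
nodeParity? n (i , j) = (∣ i + j - + n ∣ % 2) ℕ.≟ 0

Node : ℕ → Point → Set
Node n p = PointIn (suc n) p × NodeParity n p

InteriorNode : ℕ → Point → Set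
InteriorNode n p = Node n p × PointIn n p

interiorNode? : ∀ n p → Dec (InteriorNode n p)
interiorNode? n p = (pointIn? (suc n) p ×-dec nodeParity? n p) ×-dec pointIn? n p

LatticeSquare : ℕ → Square → Set
LatticeSquare n s = SquareIn (suc n) s

BoundarySquare : ℕ → Square → Set
BoundarySquare n s = SquareIn (suc n) s × ¬ SquareIn n s

nodeCorners : ℕ → Square → Point × Point
nodeCorners n (k , l) with (∣ k + l - + n ∣ % 2) ℕ.≟ 0
... | yes _ = (k , l) , (k + 1ℤ , l + 1ℤ)
... | no  _ = (k + 1ℤ , l) , (k , l + 1ℤ)

-- A choice of arrow in every square: true = the arrow points to the upper
-- node corner, false = to the lower node corner.  (Values on squares
-- outside A_{n+1} are irrelevant.)
Arrows : Set
Arrows = Square → Bool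

head : ℕ → Arrows → Square → Point
head n F s = if F s then proj₂ (nodeCorners n s) else proj₁ (nodeCorners n s)

tail : ℕ → Arrows → Square → Point
tail n F s = if F s then proj₁ (nodeCorners n s) else proj₂ (nodeCorners n s)

PointsTo : ℕ → Arrows → Square → Point → Set
PointsTo n F s N = head n F s ≡ N

PointsFrom : ℕ → Arrows → Square → Point → Set
PointsFrom n F s N = tail n F s ≡ N

-- the four squares around a point N = (i,j):
-- sqSW, sqNE are collinear (meet only at N); likewise sqNW, sqSE.
sqSW sqNE sqNW sqSE : Point → Square
sqSW (i , j) = (i - 1ℤ , j - 1ℤ)
sqNE (i , j) = (i , j)
sqNW (i , j) = (i - 1ℤ , j)
sqSE (i , j) = (i , j - 1ℤ)

Attracting : ℕ → Arrows → Point → Set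
Attracting n F N =
  PointsTo n F (sqSW N) N × PointsTo n F (sqNE N) N ×
  PointsTo n F (sqNW N) N × PointsTo n F (sqSE N) N

Repelling : ℕ → Arrows → Point → Set
Repelling n F N =
  PointsFrom n F (sqSW N) N × PointsFrom n F (sqNE N) N ×
  PointsFrom n F (sqNW N) N × PointsFrom n F (sqSE N) N

_⇔'_ : Set → Set → Set
A ⇔' B = (A → B) × (B → A)

-- collinear arrows point in the same direction: one enters N iff the
-- other leaves N.
Transient : ℕ → Arrows → Point → Set
Transient n F N =
  (PointsTo n F (sqSW N) N ⇔' PointsFrom n F (sqNE N) N) ×
  (PointsTo n F (sqNE N) N ⇔' PointsFrom n F (sqSW N) N) ×
  (PointsTo n F (sqNW N) N ⇔' PointsFrom n F (sqSE N) N) ×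
  (PointsTo n F (sqSE N) N ⇔' PointsFrom n F (sqNW N) N)

_≟P_ : (p q : Point) → Dec (p ≡ q)
_≟P_ = ≡-dec _≟ℤ_ _≟ℤ_

attracting? : ∀ n F N → Dec (Attracting n F N)
attracting? n F N =
  (head n F (sqSW N) ≟P N) ×-dec (head n F (sqNE N) ≟P N) ×-dec
  (head n F (sqNW N) ≟P N) ×-dec (head n F (sqSE N) ≟P N)

repelling? : ∀ n F N → Dec (Repelling n F N)
repelling? n F N =
  (tail n F (sqSW N) ≟P N) ×-dec (tail n F (sqNE N) ≟P N) ×-dec
  (tail n F (sqNW N) ≟P N) ×-dec (tail n F (sqSE N) ≟P N)

IsFieldOfArrows : ℕ → Arrows → Set
IsFieldOfArrows n F =
  ∀ N → InteriorNode n N → Attracting n F N ⊎ Repelling n F N ⊎ Transient n F N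

-- outward pointing: in each boundary square the arrow points to its
-- non-interior node corner (i.e. its head is not a point of A_n).
OutwardPointing : ℕ → Arrows → Set
OutwardPointing n F = ∀ s → BoundarySquare n s → ¬ PointIn n (head n F s)

-- all lattice points in the box [-(n+1), n+1]², which contains A_{n+1}
range : ℕ → List ℤ
range n = map (λ t → + t - + (suc n)) (upTo (suc (2 ℕ.* suc n)))

box : ℕ → List Point
box n = cartesianProduct (range n) (range n)

numRepelling : ℕ → Arrows → ℕ
numRepelling n F = length (filter (λ N → interiorNode? n N ×-dec repelling? n F N) (box n))

numAttracting : ℕ → Arrows → ℕ
numAttracting n F = length (filter (λ N → interiorNode? n N ×-dec attracting? n F N) (box n))

-- Double counting of flows.  The arrow in a square has flow +1 at its tail
-- and −1 at its head; the divergence of a point is the total flow at it of the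
-- arrows in its four surrounding squares.  At an interior node the divergence
-- is 4, −4 or 0 according as the node is repelling, attracting or transient,
-- so summing the divergence over the interior nodes gives 4 (r − a).
-- Regrouped by squares, the same sum assigns to each square its flux
-- [tail interior] − [head interior].  Interior nodes are the nodes of ℓ¹-norm
-- ≤ n, and the two node corners of a square have norms {c, c + 2} or
-- {c + 1, c + 1}, where c = min (|x| + |y|) over the square; by parity the
-- flux is therefore [c = n], using outward pointing on the boundary squares
-- (c = n).  Finally there are 4 (n + 1) boundary squares.

module Submission where

open import Defs
open import Data.Nat using (ℕ; suc; _≤_)
open import Data.Integer using (+_; _-_)
open import Relation.Binary.PropositionalEquality using (_≡_)

open import Data.Nat as ℕ using (zero; z≤n; s≤s; _<_; _∸_)
import Data.Nat.Properties as ℕP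
open import Data.Nat.DivMod using (_%_)
open import Data.Integer as ℤ using (ℤ; -[1+_]; _+_; _*_; 0ℤ; 1ℤ; ∣_∣; _⊖_)
import Data.Integer.Properties as ℤP
open import Data.Integer.Tactic.RingSolver using (solve-∀)
open import Data.Bool using (Bool; true; false; not; _xor_)
open import Data.Bool.Properties using (not-involutive; not-distribˡ-xor; not-distribʳ-xor; xor-comm; xor-same; true-xor; ¬-not)
open import Data.List using (List; []; _∷_; map; _++_; applyUpTo; upTo; cartesianProduct; cartesianProductWith; filter; length)
open import Data.Product using (_×_; _,_; proj₁; proj₂)
open import Data.Sum using (_⊎_; inj₁; inj₂)
open import Data.Empty using (⊥-elim)
open import Function using (_∘_)
open import Relation.Binary using (tri<; tri≈; tri>)
open import Relation.Binary.PropositionalEquality using (refl; sym; trans; cong; cong₂; subst; subst₂; _≢_; module ≡-Reasoning)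
open import Relation.Nullary using (¬_; Dec; yes; no)
open import Relation.Nullary.Decidable using (_×-dec_)
open import Relation.Unary using (Pred; Decidable)

χ : ∀ {p} {P : Set p} → Dec P → ℤ
χ (yes _) = 1ℤ
χ (no _)  = 0ℤ

χ-yes : ∀ {p} {P : Set p} (d : Dec P) → P → χ d ≡ 1ℤ
χ-yes (yes _) _ = refl
χ-yes (no ¬p) p = ⊥-elim (¬p p)

χ-no : ∀ {p} {P : Set p} (d : Dec P) → ¬ P → χ d ≡ 0ℤ
χ-no (yes p) ¬p = ⊥-elim (¬p p)
χ-no (no _)  _  = refl

χ-⇔ : ∀ {p q} {P : Set p} {Q : Set q} (d : Dec P) (e : Dec Q) → (P → Q) → (Q → P) → χ d ≡ χ e
χ-⇔ (yes p) e f g = sym (χ-yes e (f p))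
χ-⇔ (no ¬p) e f g = sym (χ-no e (λ q → ¬p (g q)))

χ-× : ∀ {p q} {P : Set p} {Q : Set q} (d : Dec P) (e : Dec Q) → χ (d ×-dec e) ≡ χ d * χ e
χ-× (yes _) (yes _) = refl
χ-× (yes _) (no _)  = refl
χ-× (no _)  (yes _) = refl
χ-× (no _)  (no _)  = refl

∑< : ℕ → (ℕ → ℤ) → ℤ
∑< zero    f = 0ℤ
∑< (suc N) f = f 0 + ∑< N (λ t → f (suc t))

∑<-cong : ∀ N {f g : ℕ → ℤ} → (∀ t → t ℕ.< N → f t ≡ g t) → ∑< N f ≡ ∑< N g
∑<-cong zero    h = refl
∑<-cong (suc N) h = cong₂ _+_ (h 0 (s≤s z≤n)) (∑<-cong N (λ t t<N → h (suc t) (s≤s t<N)))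

∑<-snoc : ∀ N f → ∑< (suc N) f ≡ ∑< N f + f N
∑<-snoc zero    f = trans (ℤP.+-identityʳ (f 0)) (sym (ℤP.+-identityˡ (f 0)))
∑<-snoc (suc N) f = begin
  f 0 + ∑< (suc N) (λ t → f (suc t))          ≡⟨ cong (_+_ (f 0)) (∑<-snoc N (λ t → f (suc t))) ⟩
  f 0 + (∑< N (λ t → f (suc t)) + f (suc N))  ≡⟨ ℤP.+-assoc (f 0) _ _ ⟨
  f 0 + ∑< N (λ t → f (suc t)) + f (suc N)    ∎
  where open ≡-Reasoning

∑<-+ : ∀ N f g → ∑< N (λ t → f t + g t) ≡ ∑< N f + ∑< N g
∑<-+ zero    f g = refl
∑<-+ (suc N) f g rewrite ∑<-+ N (λ t → f (suc t)) (λ t → g (suc t)) =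
  interchange (f 0) (g 0) _ _
  where
  interchange : ∀ a b c d → a + b + (c + d) ≡ a + c + (b + d)
  interchange = solve-∀

∑<-− : ∀ N f g → ∑< N (λ t → f t - g t) ≡ ∑< N f - ∑< N g
∑<-− zero    f g = refl
∑<-− (suc N) f g rewrite ∑<-− N (λ t → f (suc t)) (λ t → g (suc t)) =
  interchange (f 0) (g 0) _ _
  where
  interchange : ∀ a b c d → a - b + (c - d) ≡ a + c - (b + d)
  interchange = solve-∀

∑<-*ʳ : ∀ N f c → ∑< N (λ t → f t * c) ≡ ∑< N f * c
∑<-*ʳ zero    f c = sym (ℤP.*-zeroˡ c)
∑<-*ʳ (suc N) f c rewrite ∑<-*ʳ N (λ t → f (suc t)) c = sym (ℤP.*-distribʳ-+ c (f 0) _)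

∑<-split : ∀ a b f → ∑< (a ℕ.+ b) f ≡ ∑< a f + ∑< b (λ u → f (a ℕ.+ u))
∑<-split zero    b f = sym (ℤP.+-identityˡ _)
∑<-split (suc a) b f rewrite ∑<-split a b (λ t → f (suc t)) = sym (ℤP.+-assoc (f 0) _ _)

∑<-reverse : ∀ N f → ∑< (suc N) (λ t → f (N ∸ t)) ≡ ∑< (suc N) f
∑<-reverse zero    f = refl
∑<-reverse (suc N) f = begin
  f (suc N) + ∑< (suc N) (λ t → f (N ∸ t))  ≡⟨ cong (_+_ (f (suc N))) (∑<-reverse N f) ⟩
  f (suc N) + ∑< (suc N) f                  ≡⟨ ℤP.+-comm (f (suc N)) _ ⟩
  ∑< (suc N) f + f (suc N)                  ≡⟨ ∑<-snoc (suc N) f ⟨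
  ∑< (suc (suc N)) f                        ∎
  where open ≡-Reasoning

∑<-shift : ∀ N f → f 0 ≡ 0ℤ → f N ≡ 0ℤ → ∑< N f ≡ ∑< N (λ t → f (suc t))
∑<-shift N f f0≡0 fN≡0 = begin
  ∑< N f                          ≡⟨ ℤP.+-identityʳ _ ⟨
  ∑< N f + 0ℤ                     ≡⟨ cong (_+_ (∑< N f)) fN≡0 ⟨
  ∑< N f + f N                    ≡⟨ ∑<-snoc N f ⟨
  f 0 + ∑< N (λ t → f (suc t))    ≡⟨ cong (_+ ∑< N (λ t → f (suc t))) f0≡0 ⟩
  0ℤ + ∑< N (λ t → f (suc t))     ≡⟨ ℤP.+-identityˡ _ ⟩
  ∑< N (λ t → f (suc t))          ∎
  where open ≡-Reasoning

∑<-zero : ∀ N f → (∀ t → t ℕ.< N → f t ≡ 0ℤ) → ∑< N f ≡ 0ℤ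
∑<-zero zero    f h = refl
∑<-zero (suc N) f h
  rewrite h 0 (s≤s z≤n) | ∑<-zero N (λ t → f (suc t)) (λ t t<N → h (suc t) (s≤s t<N)) = refl

∑<-one : ∀ N f → (∀ t → t ℕ.< N → f t ≡ 1ℤ) → ∑< N f ≡ + N
∑<-one zero    f h = refl
∑<-one (suc N) f h
  rewrite h 0 (s≤s z≤n) | ∑<-one N (λ t → f (suc t)) (λ t t<N → h (suc t) (s≤s t<N)) = refl

∑<-single : ∀ N t₀ f → t₀ ℕ.< N → f t₀ ≡ 1ℤ → (∀ t → t ℕ.< N → t ≢ t₀ → f t ≡ 0ℤ) → ∑< N f ≡ 1ℤ
∑<-single (suc N) zero f _ f0≡1 rest
  rewrite f0≡1 | ∑<-zero N (λ t → f (suc t)) (λ t t<N → rest (suc t) (s≤s t<N) (λ ())) = refl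
∑<-single (suc N) (suc t₀) f (s≤s t₀<N) ft₀≡1 rest
  rewrite rest 0 (s≤s z≤n) (λ ())
        | ∑<-single N t₀ (λ t → f (suc t)) t₀<N ft₀≡1
            (λ t t<N t≢t₀ → rest (suc t) (s≤s t<N) (λ e → t≢t₀ (ℕP.suc-injective e))) = refl

∑ₗ : ∀ {a} {A : Set a} → List A → (A → ℤ) → ℤ
∑ₗ []       f = 0ℤ
∑ₗ (x ∷ xs) f = f x + ∑ₗ xs f

∑ₗ-++ : ∀ {a} {A : Set a} (xs ys : List A) f → ∑ₗ (xs ++ ys) f ≡ ∑ₗ xs f + ∑ₗ ys f
∑ₗ-++ []       ys f = sym (ℤP.+-identityˡ _)
∑ₗ-++ (x ∷ xs) ys f rewrite ∑ₗ-++ xs ys f = sym (ℤP.+-assoc (f x) _ _)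

∑ₗ-map : ∀ {a b} {A : Set a} {B : Set b} (g : A → B) xs f → ∑ₗ (map g xs) f ≡ ∑ₗ xs (λ x → f (g x))
∑ₗ-map g []       f = refl
∑ₗ-map g (x ∷ xs) f rewrite ∑ₗ-map g xs f = refl

∑ₗ-cartesianProduct : ∀ {a b} {A : Set a} {B : Set b} (xs : List A) (ys : List B) f →
  ∑ₗ (cartesianProduct xs ys) f ≡ ∑ₗ xs (λ x → ∑ₗ ys (λ y → f (x , y)))
∑ₗ-cartesianProduct []       ys f = refl
∑ₗ-cartesianProduct (x ∷ xs) ys f = begin
  ∑ₗ (map (x ,_) ys ++ cartesianProductWith _,_ xs ys) f
    ≡⟨ ∑ₗ-++ (map (x ,_) ys) (cartesianProductWith _,_ xs ys) f ⟩
  ∑ₗ (map (x ,_) ys) f + ∑ₗ (cartesianProduct xs ys) f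
    ≡⟨ cong₂ _+_ (∑ₗ-map (x ,_) ys f) (∑ₗ-cartesianProduct xs ys f) ⟩
  ∑ₗ ys (λ y → f (x , y)) + ∑ₗ xs (λ x′ → ∑ₗ ys (λ y → f (x′ , y))) ∎
  where open ≡-Reasoning

∑ₗ-applyUpTo : ∀ {a} {A : Set a} (g : ℕ → A) N f → ∑ₗ (applyUpTo g N) f ≡ ∑< N (λ t → f (g t))
∑ₗ-applyUpTo g zero    f = refl
∑ₗ-applyUpTo g (suc N) f rewrite ∑ₗ-applyUpTo (λ t → g (suc t)) N f = refl

length-filter : ∀ {a p} {A : Set a} {P : Pred A p} (P? : Decidable P) xs →
  + length (filter P? xs) ≡ ∑ₗ xs (λ x → χ (P? x))
length-filter P? [] = refl
length-filter P? (x ∷ xs) with P? x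
... | yes _ = trans (ℤP.pos-+ 1 _) (cong (_+_ 1ℤ) (length-filter P? xs))
... | no _  = trans (length-filter P? xs) (sym (ℤP.+-identityˡ _))

χ-guard : ∀ {p} {P : Set p} (d : Dec P) {x y : ℤ} → (P → x ≡ y) → χ d * x ≡ χ d * y
χ-guard (yes p) h = cong (_*_ 1ℤ) (h p)
χ-guard (no _) {x} {y} h = trans (ℤP.*-zeroˡ x) (sym (ℤP.*-zeroˡ y))

odd : ℕ → Bool
odd zero    = false
odd (suc m) = not (odd m)

odd⇒%2 : ∀ m → odd m ≡ false → m % 2 ≡ 0
odd⇒%2 zero          _ = refl
odd⇒%2 (suc zero)    ()
odd⇒%2 (suc (suc m)) h = odd⇒%2 m (trans (sym (not-involutive (odd m))) h)

%2⇒odd : ∀ m → m % 2 ≡ 0 → odd m ≡ false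
%2⇒odd zero          _ = refl
%2⇒odd (suc zero)    ()
%2⇒odd (suc (suc m)) h = trans (not-involutive (odd m)) (%2⇒odd m h)

odd-+ : ∀ m n → odd (m ℕ.+ n) ≡ odd m xor odd n
odd-+ zero    n = refl
odd-+ (suc m) n = trans (cong not (odd-+ m n)) (not-distribˡ-xor (odd m) (odd n))

odd-suc-suc : ∀ m → odd (suc (suc m)) ≡ odd m
odd-suc-suc m = not-involutive (odd m)

odd-+-suc-self : ∀ m → odd (m ℕ.+ suc m) ≡ true
odd-+-suc-self m = begin
  odd (m ℕ.+ suc m)          ≡⟨ odd-+ m (suc m) ⟩
  odd m xor not (odd m)      ≡⟨ not-distribʳ-xor (odd m) (odd m) ⟨
  not (odd m xor odd m)      ≡⟨ cong not (xor-same (odd m)) ⟩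
  true                       ∎
  where open ≡-Reasoning

even⇒suc≢ : ∀ m n → odd (m ℕ.+ n) ≡ false → suc m ≢ n
even⇒suc≢ m n even refl with trans (sym even) (odd-+-suc-self m)
... | ()

even⇒≢ : ∀ m n → odd (suc m ℕ.+ n) ≡ false → m ≢ n
even⇒≢ m n even refl with trans (sym even) (trans (cong odd (ℕP.+-comm (suc m) m)) (odd-+-suc-self m))
... | ()

oddℤ : ℤ → Bool
oddℤ i = odd ∣ i ∣

oddℤ-⊖ : ∀ m n → oddℤ (m ⊖ n) ≡ odd (m ℕ.+ n)
oddℤ-⊖ zero    zero    = refl
oddℤ-⊖ zero    (suc n) = refl
oddℤ-⊖ (suc m) zero    = cong (λ k → odd (suc k)) (sym (ℕP.+-identityʳ m))
oddℤ-⊖ (suc m) (suc n) = begin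
  oddℤ (suc m ⊖ suc n)          ≡⟨ cong oddℤ (ℤP.[1+m]⊖[1+n]≡m⊖n m n) ⟩
  oddℤ (m ⊖ n)                  ≡⟨ oddℤ-⊖ m n ⟩
  odd (m ℕ.+ n)                 ≡⟨ odd-suc-suc (m ℕ.+ n) ⟨
  odd (suc (suc (m ℕ.+ n)))     ≡⟨ cong (λ k → odd (suc k)) (ℕP.+-suc m n) ⟨
  odd (suc m ℕ.+ suc n)         ∎
  where open ≡-Reasoning

oddℤ-+ : ∀ i j → oddℤ (i + j) ≡ oddℤ i xor oddℤ j
oddℤ-+ (+ m)    (+ n)    = odd-+ m n
oddℤ-+ (+ m)    -[1+ n ] = trans (oddℤ-⊖ m (suc n)) (odd-+ m (suc n))
oddℤ-+ -[1+ m ] (+ n)    =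
  trans (oddℤ-⊖ n (suc m)) (trans (odd-+ n (suc m)) (xor-comm (odd n) (odd (suc m))))
oddℤ-+ -[1+ m ] -[1+ n ] = begin
  odd (suc (suc (m ℕ.+ n)))             ≡⟨ odd-suc-suc (m ℕ.+ n) ⟩
  odd (m ℕ.+ n)                         ≡⟨ odd-+ m n ⟩
  odd m xor odd n                       ≡⟨ not-involutive _ ⟨
  not (not (odd m xor odd n))           ≡⟨ cong not (not-distribʳ-xor (odd m) (odd n)) ⟩
  not (odd m xor not (odd n))           ≡⟨ not-distribˡ-xor (odd m) (not (odd n)) ⟩
  odd (suc m) xor odd (suc n)           ∎
  where open ≡-Reasoning

oddℤ-neg : ∀ i → oddℤ (ℤ.- i) ≡ oddℤ i
oddℤ-neg i = cong odd (ℤP.∣-i∣≡∣i∣ i)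

oddℤ-suc : ∀ i → oddℤ (i + 1ℤ) ≡ not (oddℤ i)
oddℤ-suc i = trans (oddℤ-+ i 1ℤ) (trans (xor-comm (oddℤ i) true) (true-xor (oddℤ i)))

oddℤ-node : ∀ n i j → oddℤ (i + j - + n) ≡ odd (∣ i ∣ ℕ.+ ∣ j ∣ ℕ.+ n)
oddℤ-node n i j = begin
  oddℤ (i + j - + n)                        ≡⟨ oddℤ-+ (i + j) (ℤ.- + n) ⟩
  oddℤ (i + j) xor oddℤ (ℤ.- + n)           ≡⟨ cong₂ _xor_ (oddℤ-+ i j) (oddℤ-neg (+ n)) ⟩
  (oddℤ i xor oddℤ j) xor odd n             ≡⟨ cong (_xor odd n) (odd-+ ∣ i ∣ ∣ j ∣) ⟨
  odd (∣ i ∣ ℕ.+ ∣ j ∣) xor odd n           ≡⟨ odd-+ (∣ i ∣ ℕ.+ ∣ j ∣) n ⟨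
  odd (∣ i ∣ ℕ.+ ∣ j ∣ ℕ.+ n)               ∎
  where open ≡-Reasoning

minAbs-around : ∀ i → (minAbs (i - 1ℤ) ≡ ∣ i ∣ ∸ 1 × minAbs i ≡ ∣ i ∣)
                    ⊎ (minAbs i ≡ ∣ i ∣ ∸ 1 × minAbs (i - 1ℤ) ≡ ∣ i ∣)
minAbs-around (+ zero)  = inj₁ (refl , refl)
minAbs-around (+ suc a) = inj₁ (refl , refl)
minAbs-around -[1+ a ]  = inj₂ (refl , cong suc (ℕP.+-identityʳ a))

minAbs-around-≥ : ∀ i → ∣ i ∣ ∸ 1 ≤ minAbs (i - 1ℤ) × ∣ i ∣ ∸ 1 ≤ minAbs i
minAbs-around-≥ i with minAbs-around i
... | inj₁ (e₁ , e₂) = ℕP.≤-reflexive (sym e₁) , subst (∣ i ∣ ∸ 1 ≤_) (sym e₂) (ℕP.m∸n≤m ∣ i ∣ 1)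
... | inj₂ (e₁ , e₂) = subst (∣ i ∣ ∸ 1 ≤_) (sym e₂) (ℕP.m∸n≤m ∣ i ∣ 1) , ℕP.≤-reflexive (sym e₁)

-- A lattice point (i , j) lies in A_m iff (|i| ∸ 1) + (|j| ∸ 1) < m: the
-- best of its four surrounding squares realises both minima at once.
pointIn⇒ : ∀ m i j → PointIn m (i , j) → (∣ i ∣ ∸ 1) ℕ.+ (∣ j ∣ ∸ 1) < m
pointIn⇒ m i j inA with minAbs-around-≥ i | minAbs-around-≥ j | inA
... | a₁ , _  | b₁ , _  | inj₁ s                 = ℕP.≤-<-trans (ℕP.+-mono-≤ a₁ b₁) s
... | a₁ , _  | _  , b₂ | inj₂ (inj₁ s)          = ℕP.≤-<-trans (ℕP.+-mono-≤ a₁ b₂) s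
... | _  , a₂ | b₁ , _  | inj₂ (inj₂ (inj₁ s))   = ℕP.≤-<-trans (ℕP.+-mono-≤ a₂ b₁) s
... | _  , a₂ | _  , b₂ | inj₂ (inj₂ (inj₂ s))   = ℕP.≤-<-trans (ℕP.+-mono-≤ a₂ b₂) s

pointIn⇐ : ∀ m i j → (∣ i ∣ ∸ 1) ℕ.+ (∣ j ∣ ∸ 1) < m → PointIn m (i , j)
pointIn⇐ m i j small with minAbs-around i | minAbs-around j
... | inj₁ (e , _) | inj₁ (f , _) = inj₁ (subst₂ (λ x y → x ℕ.+ y < m) (sym e) (sym f) small)
... | inj₁ (e , _) | inj₂ (f , _) = inj₂ (inj₁ (subst₂ (λ x y → x ℕ.+ y < m) (sym e) (sym f) small))
... | inj₂ (e , _) | inj₁ (f , _) = inj₂ (inj₂ (inj₁ (subst₂ (λ x y → x ℕ.+ y < m) (sym e) (sym f) small)))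
... | inj₂ (e , _) | inj₂ (f , _) = inj₂ (inj₂ (inj₂ (subst₂ (λ x y → x ℕ.+ y < m) (sym e) (sym f) small)))

norm₁ : Point → ℕ
norm₁ (i , j) = ∣ i ∣ ℕ.+ ∣ j ∣

nodeParity⇒ : ∀ n i j → NodeParity n (i , j) → oddℤ (i + j - + n) ≡ false
nodeParity⇒ n i j = %2⇒odd ∣ i + j - + n ∣

nodeParity⇐ : ∀ n i j → oddℤ (i + j - + n) ≡ false → NodeParity n (i , j)
nodeParity⇐ n i j = odd⇒%2 ∣ i + j - + n ∣

parity⇒ : ∀ n i j → NodeParity n (i , j) → odd (norm₁ (i , j) ℕ.+ n) ≡ false
parity⇒ n i j p = trans (sym (oddℤ-node n i j)) (nodeParity⇒ n i j p)

-- For u + v of the right parity, the test (u ∸ 1) + (v ∸ 1) < n amounts to u + v ≤ n: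
-- the only other candidate, u + v = n + 1, has the wrong parity.
norm≤-of-test : ∀ n u v → (u ∸ 1) ℕ.+ (v ∸ 1) < n → odd (u ℕ.+ v ℕ.+ n) ≡ false → u ℕ.+ v ≤ n
norm≤-of-test n u v small even with ℕP.m≤n⇒m<n∨m≡n u+v≤1+n
  where
  ≤-suc-pred : ∀ w → w ≤ suc (w ∸ 1)
  ≤-suc-pred zero    = z≤n
  ≤-suc-pred (suc w) = ℕP.≤-refl
  u+v≤1+n : u ℕ.+ v ≤ suc n
  u+v≤1+n = ℕP.≤-trans (ℕP.+-mono-≤ (≤-suc-pred u) (≤-suc-pred v))
              (subst (_≤ suc n) (sym (cong suc (ℕP.+-suc (u ∸ 1) (v ∸ 1)))) (s≤s small))
... | inj₁ u+v<1+n = ℕP.≤-pred u+v<1+n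
... | inj₂ u+v≡1+n with trans (sym even) (trans (cong (λ w → odd (w ℕ.+ n)) u+v≡1+n)
                                           (trans (cong odd (ℕP.+-comm (suc n) n)) (odd-+-suc-self n)))
...   | ()

test-of-norm≤ : ∀ n u v → 1 ≤ n → u ℕ.+ v ≤ n → (u ∸ 1) ℕ.+ (v ∸ 1) < n
test-of-norm≤ n zero    zero    1≤n _  = 1≤n
test-of-norm≤ n zero    (suc v) _   le = le
test-of-norm≤ n (suc u) v       _   le = ℕP.<-≤-trans (s≤s (ℕP.+-monoʳ-≤ u (ℕP.m∸n≤m v 1))) le

interior⇒norm≤ : ∀ n i j → InteriorNode n (i , j) → norm₁ (i , j) ≤ n
interior⇒norm≤ n i j ((_ , p) , inAₙ) =
  norm≤-of-test n ∣ i ∣ ∣ j ∣ (pointIn⇒ n i j inAₙ) (parity⇒ n i j p)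

norm≤⇒interior : ∀ n i j → 1 ≤ n → NodeParity n (i , j) → norm₁ (i , j) ≤ n → InteriorNode n (i , j)
norm≤⇒interior n i j 1≤n p le =
  (pointIn⇐ (suc n) i j (ℕP.m≤n⇒m≤1+n small) , p) , pointIn⇐ n i j small
  where
  small : (∣ i ∣ ∸ 1) ℕ.+ (∣ j ∣ ∸ 1) < n
  small = test-of-norm≤ n ∣ i ∣ ∣ j ∣ 1≤n le

parity-diagonal : ∀ n k l → NodeParity n (k , l) → NodeParity n (k + 1ℤ , l + 1ℤ)
parity-diagonal n k l p = nodeParity⇐ n (k + 1ℤ) (l + 1ℤ) (begin
  oddℤ (k + 1ℤ + (l + 1ℤ) - + n)          ≡⟨ cong oddℤ (shift k l (+ n)) ⟩
  oddℤ (k + l - + n + 1ℤ + 1ℤ)            ≡⟨ oddℤ-suc (k + l - + n + 1ℤ) ⟩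
  not (oddℤ (k + l - + n + 1ℤ))           ≡⟨ cong not (oddℤ-suc (k + l - + n)) ⟩
  not (not (oddℤ (k + l - + n)))          ≡⟨ not-involutive _ ⟩
  oddℤ (k + l - + n)                      ≡⟨ nodeParity⇒ n k l p ⟩
  false                                   ∎)
  where
  open ≡-Reasoning
  shift : ∀ k l m → k + 1ℤ + (l + 1ℤ) - m ≡ k + l - m + 1ℤ + 1ℤ
  shift = solve-∀

flip-parity : ∀ n k l i j → i + j - + n ≡ k + l - + n + 1ℤ →
  ¬ NodeParity n (k , l) → NodeParity n (i , j)
flip-parity n k l i j shifted ¬p = nodeParity⇐ n i j (begin
  oddℤ (i + j - + n)             ≡⟨ cong oddℤ shifted ⟩
  oddℤ (k + l - + n + 1ℤ)        ≡⟨ oddℤ-suc (k + l - + n) ⟩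
  not (oddℤ (k + l - + n))       ≡⟨ cong not (¬-not (¬p ∘ nodeParity⇐ n k l)) ⟩
  false                          ∎)
  where open ≡-Reasoning

parity-right : ∀ n k l → ¬ NodeParity n (k , l) → NodeParity n (k + 1ℤ , l)
parity-right n k l = flip-parity n k l (k + 1ℤ) l (rearrange k l (+ n))
  where
  rearrange : ∀ k l m → k + 1ℤ + l - m ≡ k + l - m + 1ℤ
  rearrange = solve-∀

parity-up : ∀ n k l → ¬ NodeParity n (k , l) → NodeParity n (k , l + 1ℤ)
parity-up n k l = flip-parity n k l k (l + 1ℤ) (rearrange k l (+ n))
  where
  rearrange : ∀ k l m → k + (l + 1ℤ) - m ≡ k + l - m + 1ℤ
  rearrange = solve-∀

Consecutive : ℕ → ℕ → ℕ → Set
Consecutive a x x′ = (x ≡ a × x′ ≡ suc a) ⊎ (x ≡ suc a × x′ ≡ a)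

consecutive-swap : ∀ {a x x′} → Consecutive a x x′ → Consecutive a x′ x
consecutive-swap (inj₁ (e , f)) = inj₂ (f , e)
consecutive-swap (inj₂ (e , f)) = inj₁ (f , e)

abs-consecutive : ∀ k → Consecutive (minAbs k) ∣ k ∣ ∣ k + 1ℤ ∣
abs-consecutive (+ a)    = inj₁ (refl , ℕP.+-comm a 1)
abs-consecutive -[1+ a ] = inj₂ (refl , ℤP.∣⊖∣-≤ (ℕ.s≤s ℕ.z≤n))

-- The norms s, t of two opposite corners of a square Q with
-- c = min_Q (|x| + |y|): either {c, c + 2} or c + 1 twice.
Opposite : ℕ → ℕ → ℕ → Set
Opposite c s t = (s ≡ c × t ≡ suc (suc c)) ⊎ (s ≡ suc (suc c) × t ≡ c) ⊎ (s ≡ suc c × t ≡ suc c)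

opposite-swap : ∀ {c s t} → Opposite c s t → Opposite c t s
opposite-swap (inj₁ (e , f))        = inj₂ (inj₁ (f , e))
opposite-swap (inj₂ (inj₁ (e , f))) = inj₁ (f , e)
opposite-swap (inj₂ (inj₂ (e , f))) = inj₂ (inj₂ (f , e))

opposite-norms : ∀ {a b x x′ y y′} → Consecutive a x x′ → Consecutive b y y′ →
  Opposite (a ℕ.+ b) (x ℕ.+ y) (x′ ℕ.+ y′)
opposite-norms {a} {b} (inj₁ (refl , refl)) (inj₁ (refl , refl)) = inj₁ (refl , cong suc (ℕP.+-suc a b))
opposite-norms {a} {b} (inj₁ (refl , refl)) (inj₂ (refl , refl)) = inj₂ (inj₂ (ℕP.+-suc a b , refl))
opposite-norms {a} {b} (inj₂ (refl , refl)) (inj₁ (refl , refl)) = inj₂ (inj₂ (refl , ℕP.+-suc a b))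
opposite-norms {a} {b} (inj₂ (refl , refl)) (inj₂ (refl , refl)) = inj₂ (inj₁ (cong suc (ℕP.+-suc a b) , refl))

diagonal-norms : ∀ k l → Opposite (minAbs k ℕ.+ minAbs l) (norm₁ (k , l)) (norm₁ (k + 1ℤ , l + 1ℤ))
diagonal-norms k l = opposite-norms (abs-consecutive k) (abs-consecutive l)

antidiagonal-norms : ∀ k l → Opposite (minAbs k ℕ.+ minAbs l) (norm₁ (k + 1ℤ , l)) (norm₁ (k , l + 1ℤ))
antidiagonal-norms k l = opposite-norms (consecutive-swap (abs-consecutive k)) (abs-consecutive l)

Corner : ℤ → ℤ → Point → Set
Corner k l p = p ≡ (k , l) ⊎ p ≡ (k + 1ℤ , l + 1ℤ) ⊎ p ≡ (k + 1ℤ , l) ⊎ p ≡ (k , l + 1ℤ)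

k≢k+1 : ∀ k → k ≢ k + 1ℤ
k≢k+1 k e = ℤP.i≢suc[i] (trans e (ℤP.+-comm k 1ℤ))

record ArrowShape (n : ℕ) (F : Arrows) (k l : ℤ) : Set where
  field
    T H      : Point
    tail≡T   : tail n F (k , l) ≡ T
    head≡H   : head n F (k , l) ≡ H
    T≢H      : T ≢ H
    T-corner : Corner k l T
    H-corner : Corner k l H
    T-node   : NodeParity n T
    H-node   : NodeParity n H
    opposite : Opposite (minAbs k ℕ.+ minAbs l) (norm₁ T) (norm₁ H)

Endpoints : ℕ → Arrows → ℤ → ℤ → Set
Endpoints n F k l =
    NodeParity n (k , l) × tail n F (k , l) ≡ (k , l) × head n F (k , l) ≡ (k + 1ℤ , l + 1ℤ)
  ⊎ NodeParity n (k , l) × tail n F (k , l) ≡ (k + 1ℤ , l + 1ℤ) × head n F (k , l) ≡ (k , l)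
  ⊎ ¬ NodeParity n (k , l) × tail n F (k , l) ≡ (k + 1ℤ , l) × head n F (k , l) ≡ (k , l + 1ℤ)
  ⊎ ¬ NodeParity n (k , l) × tail n F (k , l) ≡ (k , l + 1ℤ) × head n F (k , l) ≡ (k + 1ℤ , l)

endpoints : ∀ n F k l → Endpoints n F k l
endpoints n F k l with (∣ k + l - + n ∣ % 2) ℕ.≟ 0 | F (k , l)
... | yes p | true  = inj₁ (p , refl , refl)
... | yes p | false = inj₂ (inj₁ (p , refl , refl))
... | no ¬p | true  = inj₂ (inj₂ (inj₁ (¬p , refl , refl)))
... | no ¬p | false = inj₂ (inj₂ (inj₂ (¬p , refl , refl)))

arrowShape : ∀ n F k l → ArrowShape n F k l
arrowShape n F k l with endpoints n F k l
... | inj₁ (p , t≡ , h≡) = record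
  { T = k , l ; H = k + 1ℤ , l + 1ℤ ; tail≡T = t≡ ; head≡H = h≡
  ; T≢H = λ e → k≢k+1 k (cong proj₁ e)
  ; T-corner = inj₁ refl ; H-corner = inj₂ (inj₁ refl)
  ; T-node = p ; H-node = parity-diagonal n k l p
  ; opposite = diagonal-norms k l }
... | inj₂ (inj₁ (p , t≡ , h≡)) = record
  { T = k + 1ℤ , l + 1ℤ ; H = k , l ; tail≡T = t≡ ; head≡H = h≡
  ; T≢H = λ e → k≢k+1 k (sym (cong proj₁ e))
  ; T-corner = inj₂ (inj₁ refl) ; H-corner = inj₁ refl
  ; T-node = parity-diagonal n k l p ; H-node = p
  ; opposite = opposite-swap (diagonal-norms k l) }
... | inj₂ (inj₂ (inj₁ (¬p , t≡ , h≡))) = record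
  { T = k + 1ℤ , l ; H = k , l + 1ℤ ; tail≡T = t≡ ; head≡H = h≡
  ; T≢H = λ e → k≢k+1 k (sym (cong proj₁ e))
  ; T-corner = inj₂ (inj₂ (inj₁ refl)) ; H-corner = inj₂ (inj₂ (inj₂ refl))
  ; T-node = parity-right n k l ¬p ; H-node = parity-up n k l ¬p
  ; opposite = antidiagonal-norms k l }
... | inj₂ (inj₂ (inj₂ (¬p , t≡ , h≡))) = record
  { T = k , l + 1ℤ ; H = k + 1ℤ , l ; tail≡T = t≡ ; head≡H = h≡
  ; T≢H = λ e → k≢k+1 k (cong proj₁ e)
  ; T-corner = inj₂ (inj₂ (inj₂ refl)) ; H-corner = inj₂ (inj₂ (inj₁ refl))
  ; T-node = parity-up n k l ¬p ; H-node = parity-right n k l ¬p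
  ; opposite = opposite-swap (antidiagonal-norms k l) }

head≢tail : ∀ n F s → head n F s ≢ tail n F s
head≢tail n F (k , l) e = T≢H (trans (sym tail≡T) (trans (sym e) head≡H))
  where open ArrowShape (arrowShape n F k l)

flow : ℕ → Arrows → Square → Point → ℤ
flow n F s p = χ (tail n F s ≟P p) - χ (head n F s ≟P p)

flow-in : ∀ n F s p → PointsTo n F s p → flow n F s p ≡ -[1+ 0 ]
flow-in n F s p h
  rewrite χ-no (tail n F s ≟P p) (λ t → head≢tail n F s (trans h (sym t)))
        | χ-yes (head n F s ≟P p) h = refl

flow-out : ∀ n F s p → PointsFrom n F s p → flow n F s p ≡ 1ℤ
flow-out n F s p t
  rewrite χ-yes (tail n F s ≟P p) t
        | χ-no (head n F s ≟P p) (λ h → head≢tail n F s (trans h (sym t))) = refl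

flow-collinear : ∀ n F s₁ s₂ p →
  (PointsTo n F s₁ p ⇔' PointsFrom n F s₂ p) → (PointsTo n F s₂ p ⇔' PointsFrom n F s₁ p) →
  flow n F s₁ p + flow n F s₂ p ≡ 0ℤ
flow-collinear n F s₁ s₂ p (to₁ , from₂) (to₂ , from₁)
  rewrite χ-⇔ (head n F s₁ ≟P p) (tail n F s₂ ≟P p) to₁ from₂
        | χ-⇔ (head n F s₂ ≟P p) (tail n F s₁ ≟P p) to₂ from₁ =
  cancel (χ (tail n F s₁ ≟P p)) (χ (tail n F s₂ ≟P p))
  where
  cancel : ∀ a b → a - b + (b - a) ≡ 0ℤ
  cancel = solve-∀

divergence : ℕ → Arrows → Point → ℤ
divergence n F p = flow n F (sqNE p) p + flow n F (sqSW p) p + flow n F (sqNW p) p + flow n F (sqSE p) p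

divergence-attracting : ∀ n F p → Attracting n F p → divergence n F p ≡ -[1+ 3 ]
divergence-attracting n F p (sw , ne , nw , se)
  rewrite flow-in n F (sqNE p) p ne | flow-in n F (sqSW p) p sw
        | flow-in n F (sqNW p) p nw | flow-in n F (sqSE p) p se = refl

divergence-repelling : ∀ n F p → Repelling n F p → divergence n F p ≡ + 4
divergence-repelling n F p (sw , ne , nw , se)
  rewrite flow-out n F (sqNE p) p ne | flow-out n F (sqSW p) p sw
        | flow-out n F (sqNW p) p nw | flow-out n F (sqSE p) p se = refl

divergence-transient : ∀ n F p → Transient n F p → divergence n F p ≡ 0ℤ
divergence-transient n F p (sw⇔ne , ne⇔sw , nw⇔se , se⇔nw) = begin
  flow n F (sqNE p) p + flow n F (sqSW p) p + flow n F (sqNW p) p + flow n F (sqSE p) p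
    ≡⟨ ℤP.+-assoc (flow n F (sqNE p) p + flow n F (sqSW p) p) _ _ ⟩
  (flow n F (sqNE p) p + flow n F (sqSW p) p) + (flow n F (sqNW p) p + flow n F (sqSE p) p)
    ≡⟨ cong₂ _+_ (flow-collinear n F (sqNE p) (sqSW p) p ne⇔sw sw⇔ne)
                 (flow-collinear n F (sqNW p) (sqSE p) p nw⇔se se⇔nw) ⟩
  0ℤ ∎
  where open ≡-Reasoning

node-balance : ∀ n F → IsFieldOfArrows n F → ∀ p → InteriorNode n p →
  χ (repelling? n F p) * + 4 - χ (attracting? n F p) * + 4 ≡ divergence n F p
node-balance n F isField p int with attracting? n F p | repelling? n F p
... | yes a | yes (sw , _) = ⊥-elim (head≢tail n F (sqSW p) (trans (proj₁ a) (sym sw)))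
... | yes a | no _  = sym (divergence-attracting n F p a)
... | no _  | yes r = sym (divergence-repelling n F p r)
... | no ¬a | no ¬r with isField p int
...   | inj₁ a        = ⊥-elim (¬a a)
...   | inj₂ (inj₁ r) = ⊥-elim (¬r r)
...   | inj₂ (inj₂ t) = sym (divergence-transient n F p t)

interior : ℕ → Point → ℤ
interior n p = χ (interiorNode? n p)

weighted-node-balance : ∀ n F → IsFieldOfArrows n F → ∀ p →
  χ (interiorNode? n p ×-dec repelling? n F p) * + 4 - χ (interiorNode? n p ×-dec attracting? n F p) * + 4
    ≡ interior n p * divergence n F p
weighted-node-balance n F isField p = begin
  χ (int? ×-dec rep?) * + 4 - χ (int? ×-dec att?) * + 4
    ≡⟨ cong₂ (λ r a → r * + 4 - a * + 4) (χ-× int? rep?) (χ-× int? att?) ⟩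
  χ int? * χ rep? * + 4 - χ int? * χ att? * + 4
    ≡⟨ factor (χ int?) (χ rep?) (χ att?) ⟩
  χ int? * (χ rep? * + 4 - χ att? * + 4)
    ≡⟨ χ-guard int? (node-balance n F isField p) ⟩
  χ int? * divergence n F p ∎
  where
  open ≡-Reasoning
  int? : Dec (InteriorNode n p)
  int? = interiorNode? n p
  rep? : Dec (Repelling n F p)
  rep? = repelling? n F p
  att? : Dec (Attracting n F p)
  att? = attracting? n F p
  factor : ∀ i r a → i * r * + 4 - i * a * + 4 ≡ i * (r * + 4 - a * + 4)
  factor = solve-∀

cornerSum : (Point → ℤ) → ℤ → ℤ → ℤ
cornerSum f k l = f (k , l) + f (k + 1ℤ , l + 1ℤ) + f (k + 1ℤ , l) + f (k , l + 1ℤ)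

cornerSum-distrib : ∀ (f a b : Point → ℤ) k l → cornerSum (λ q → f q * (a q - b q)) k l
  ≡ cornerSum (λ q → f q * a q) k l - cornerSum (λ q → f q * b q) k l
cornerSum-distrib f a b k l = expand (f (k , l)) (a (k , l)) (b (k , l))
  (f (k + 1ℤ , l + 1ℤ)) (a (k + 1ℤ , l + 1ℤ)) (b (k + 1ℤ , l + 1ℤ))
  (f (k + 1ℤ , l)) (a (k + 1ℤ , l)) (b (k + 1ℤ , l))
  (f (k , l + 1ℤ)) (a (k , l + 1ℤ)) (b (k , l + 1ℤ))
  where
  expand : ∀ f₁ a₁ b₁ f₂ a₂ b₂ f₃ a₃ b₃ f₄ a₄ b₄ →
    f₁ * (a₁ - b₁) + f₂ * (a₂ - b₂) + f₃ * (a₃ - b₃) + f₄ * (a₄ - b₄)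
      ≡ f₁ * a₁ + f₂ * a₂ + f₃ * a₃ + f₄ * a₄ - (f₁ * b₁ + f₂ * b₂ + f₃ * b₃ + f₄ * b₄)
  expand = solve-∀

δ-self : ∀ p → χ (p ≟P p) ≡ 1ℤ
δ-self p = χ-yes (p ≟P p) refl

δ-≢₁ : ∀ {a b a′ b′} → a ≢ a′ → χ ((a , b) ≟P (a′ , b′)) ≡ 0ℤ
δ-≢₁ ne = χ-no (_ ≟P _) (λ e → ne (cong proj₁ e))

δ-≢₂ : ∀ {a b a′ b′} → b ≢ b′ → χ ((a , b) ≟P (a′ , b′)) ≡ 0ℤ
δ-≢₂ ne = χ-no (_ ≟P _) (λ e → ne (cong proj₂ e))

cornerSum-pick : ∀ (f : Point → ℤ) k l p → Corner k l p → cornerSum (λ q → f q * χ (p ≟P q)) k l ≡ f p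
cornerSum-pick f k l _ (inj₁ refl)
  rewrite δ-self (k , l) | δ-≢₁ {k} {l} {k + 1ℤ} {l + 1ℤ} (k≢k+1 k)
        | δ-≢₁ {k} {l} {k + 1ℤ} {l} (k≢k+1 k) | δ-≢₂ {k} {l} {k} {l + 1ℤ} (k≢k+1 l) =
  pick (f (k , l)) (f (k + 1ℤ , l + 1ℤ)) (f (k + 1ℤ , l)) (f (k , l + 1ℤ))
  where pick : ∀ a b c d → a * 1ℤ + b * 0ℤ + c * 0ℤ + d * 0ℤ ≡ a
        pick = solve-∀
cornerSum-pick f k l _ (inj₂ (inj₁ refl))
  rewrite δ-self (k + 1ℤ , l + 1ℤ) | δ-≢₁ {k + 1ℤ} {l + 1ℤ} {k} {l} (k≢k+1 k ∘ sym)
        | δ-≢₂ {k + 1ℤ} {l + 1ℤ} {k + 1ℤ} {l} (k≢k+1 l ∘ sym) | δ-≢₁ {k + 1ℤ} {l + 1ℤ} {k} {l + 1ℤ} (k≢k+1 k ∘ sym) =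
  pick (f (k , l)) (f (k + 1ℤ , l + 1ℤ)) (f (k + 1ℤ , l)) (f (k , l + 1ℤ))
  where pick : ∀ a b c d → a * 0ℤ + b * 1ℤ + c * 0ℤ + d * 0ℤ ≡ b
        pick = solve-∀
cornerSum-pick f k l _ (inj₂ (inj₂ (inj₁ refl)))
  rewrite δ-self (k + 1ℤ , l) | δ-≢₁ {k + 1ℤ} {l} {k} {l} (k≢k+1 k ∘ sym)
        | δ-≢₂ {k + 1ℤ} {l} {k + 1ℤ} {l + 1ℤ} (k≢k+1 l) | δ-≢₁ {k + 1ℤ} {l} {k} {l + 1ℤ} (k≢k+1 k ∘ sym) =
  pick (f (k , l)) (f (k + 1ℤ , l + 1ℤ)) (f (k + 1ℤ , l)) (f (k , l + 1ℤ))
  where pick : ∀ a b c d → a * 0ℤ + b * 0ℤ + c * 1ℤ + d * 0ℤ ≡ c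
        pick = solve-∀
cornerSum-pick f k l _ (inj₂ (inj₂ (inj₂ refl)))
  rewrite δ-self (k , l + 1ℤ) | δ-≢₂ {k} {l + 1ℤ} {k} {l} (k≢k+1 l ∘ sym)
        | δ-≢₁ {k} {l + 1ℤ} {k + 1ℤ} {l + 1ℤ} (k≢k+1 k) | δ-≢₁ {k} {l + 1ℤ} {k + 1ℤ} {l} (k≢k+1 k) =
  pick (f (k , l)) (f (k + 1ℤ , l + 1ℤ)) (f (k + 1ℤ , l)) (f (k , l + 1ℤ))
  where pick : ∀ a b c d → a * 0ℤ + b * 0ℤ + c * 0ℤ + d * 1ℤ ≡ d
        pick = solve-∀

squareFlux : ℕ → Arrows → ℤ → ℤ → ℤ
squareFlux n F k l = cornerSum (λ q → interior n q * flow n F (k , l) q) k l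

squareFlux-ends : ∀ n F k l → let open ArrowShape (arrowShape n F k l) in
  squareFlux n F k l ≡ interior n T - interior n H
squareFlux-ends n F k l = begin
  cornerSum (λ q → interior n q * (χ (tail n F (k , l) ≟P q) - χ (head n F (k , l) ≟P q))) k l
    ≡⟨ cong₂ (λ t h → cornerSum (λ q → interior n q * (χ (t ≟P q) - χ (h ≟P q))) k l) tail≡T head≡H ⟩
  cornerSum (λ q → interior n q * (χ (T ≟P q) - χ (H ≟P q))) k l
    ≡⟨ cornerSum-distrib (interior n) (λ q → χ (T ≟P q)) (λ q → χ (H ≟P q)) k l ⟩
  cornerSum (λ q → interior n q * χ (T ≟P q)) k l - cornerSum (λ q → interior n q * χ (H ≟P q)) k l
    ≡⟨ cong₂ _-_ (cornerSum-pick (interior n) k l T T-corner) (cornerSum-pick (interior n) k l H H-corner) ⟩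
  interior n T - interior n H ∎
  where
  open ≡-Reasoning
  open ArrowShape (arrowShape n F k l)

-- [c ≤ n] − [c + 2 ≤ n] = [c = n] when c ≡ n (mod 2): the value c + 1 = n is excluded.
χ-≤-step₂ : ∀ c n → odd (c ℕ.+ n) ≡ false → χ (c ℕ.≤? n) - χ (suc (suc c) ℕ.≤? n) ≡ χ (c ℕ.≟ n)
χ-≤-step₂ c n even with ℕP.<-cmp c n
... | tri< c<n c≢n _
  rewrite χ-yes (c ℕ.≤? n) (ℕP.<⇒≤ c<n)
        | χ-yes (suc (suc c) ℕ.≤? n) (ℕP.≤∧≢⇒< c<n (even⇒suc≢ c n even))
        | χ-no (c ℕ.≟ n) c≢n = refl
... | tri≈ _ c≡n _
  rewrite χ-yes (c ℕ.≤? n) (ℕP.≤-reflexive c≡n)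
        | χ-no (suc (suc c) ℕ.≤? n) (λ le → ℕP.<⇒≱ (ℕP.≤-trans (ℕP.n≤1+n _) le) (ℕP.≤-reflexive (sym c≡n)))
        | χ-yes (c ℕ.≟ n) c≡n = refl
... | tri> _ c≢n n<c
  rewrite χ-no (c ℕ.≤? n) (ℕP.<⇒≱ n<c)
        | χ-no (suc (suc c) ℕ.≤? n) (λ le → ℕP.<⇒≱ n<c (ℕP.≤-trans (ℕP.n≤1+n _) (ℕP.≤-trans (ℕP.n≤1+n _) le)))
        | χ-no (c ℕ.≟ n) c≢n = refl

opposite-contribution : ∀ n c s t → Opposite c s t → odd (s ℕ.+ n) ≡ false → (c ≡ n → ¬ t ≤ n) →
  χ (s ℕ.≤? n) - χ (t ℕ.≤? n) ≡ χ (c ℕ.≟ n)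
opposite-contribution n c s t (inj₁ (refl , refl)) even _ = χ-≤-step₂ c n even
opposite-contribution n c s t (inj₂ (inj₁ (refl , refl))) even outward = begin
  χ (suc (suc c) ℕ.≤? n) - χ (c ℕ.≤? n)          ≡⟨ swap (χ (c ℕ.≤? n)) _ ⟩
  ℤ.- (χ (c ℕ.≤? n) - χ (suc (suc c) ℕ.≤? n))   ≡⟨ cong ℤ.-_ (χ-≤-step₂ c n (trans (sym (odd-suc-suc (c ℕ.+ n))) even)) ⟩
  ℤ.- χ (c ℕ.≟ n)                                ≡⟨ cong ℤ.-_ (χ-no (c ℕ.≟ n) c≢n) ⟩
  0ℤ                                             ≡⟨ χ-no (c ℕ.≟ n) c≢n ⟨
  χ (c ℕ.≟ n)                                    ∎
  where
  open ≡-Reasoning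
  swap : ∀ a b → b - a ≡ ℤ.- (a - b)
  swap = solve-∀
  c≢n : c ≢ n
  c≢n c≡n = outward c≡n (ℕP.≤-reflexive c≡n)
opposite-contribution n c s t (inj₂ (inj₂ (refl , refl))) even _ = begin
  χ (suc c ℕ.≤? n) - χ (suc c ℕ.≤? n)   ≡⟨ ℤP.+-inverseʳ (χ (suc c ℕ.≤? n)) ⟩
  0ℤ                                    ≡⟨ χ-no (c ℕ.≟ n) (even⇒≢ c n even) ⟨
  χ (c ℕ.≟ n)                           ∎
  where open ≡-Reasoning

interior-on-node : ∀ n → 1 ≤ n → ∀ p → NodeParity n p → interior n p ≡ χ (norm₁ p ℕ.≤? n)
interior-on-node n 1≤n (i , j) node = χ-⇔ (interiorNode? n (i , j)) (norm₁ (i , j) ℕ.≤? n)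
  (interior⇒norm≤ n i j) (norm≤⇒interior n i j 1≤n node)

squareFlux-boundary : ∀ n → 1 ≤ n → ∀ F → OutwardPointing n F → ∀ k l →
  squareFlux n F k l ≡ χ (minAbs k ℕ.+ minAbs l ℕ.≟ n)
squareFlux-boundary n 1≤n F outward k l = begin
  squareFlux n F k l
    ≡⟨ squareFlux-ends n F k l ⟩
  interior n T - interior n H
    ≡⟨ cong₂ _-_ (interior-on-node n 1≤n T T-node) (interior-on-node n 1≤n H H-node) ⟩
  χ (norm₁ T ℕ.≤? n) - χ (norm₁ H ℕ.≤? n)
    ≡⟨ opposite-contribution n _ (norm₁ T) (norm₁ H) opposite
         (parity⇒ n (proj₁ T) (proj₂ T) T-node) head-outside ⟩
  χ (minAbs k ℕ.+ minAbs l ℕ.≟ n) ∎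
  where
  open ≡-Reasoning
  open ArrowShape (arrowShape n F k l)
  -- On a boundary square the head lies outside A_n, so it has norm > n.
  head-outside : minAbs k ℕ.+ minAbs l ≡ n → ¬ norm₁ H ≤ n
  head-outside c≡n H≤n = outward (k , l) (ℕ.s≤s (ℕP.≤-reflexive c≡n) , ℕP.<-irrefl c≡n)
    (subst (PointIn n) (sym head≡H) (proj₂ (norm≤⇒interior n (proj₁ H) (proj₂ H) 1≤n H-node H≤n)))

side : ℕ → ℕ
side n = suc (2 ℕ.* suc n)

coord : ℕ → ℕ → ℤ
coord n t = + t - + suc n

∑□ : ℕ → (Point → ℤ) → ℤ
∑□ n f = ∑< (side n) (λ t → ∑< (side n) (λ u → f (coord n t , coord n u)))

∑ₗ-range : ∀ n f → ∑ₗ (range n) f ≡ ∑< (side n) (λ t → f (coord n t))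
∑ₗ-range n f = trans (∑ₗ-map (coord n) (upTo (side n)) f) (∑ₗ-applyUpTo (λ t → t) (side n) (λ t → f (coord n t)))

count-box : ∀ {p} {P : Pred Point p} (P? : Decidable P) n →
  + length (filter P? (box n)) ≡ ∑□ n (λ q → χ (P? q))
count-box P? n = begin
  + length (filter P? (box n))
    ≡⟨ length-filter P? (box n) ⟩
  ∑ₗ (box n) (λ q → χ (P? q))
    ≡⟨ ∑ₗ-cartesianProduct (range n) (range n) (λ q → χ (P? q)) ⟩
  ∑ₗ (range n) (λ i → ∑ₗ (range n) (λ j → χ (P? (i , j))))
    ≡⟨ ∑ₗ-range n (λ i → ∑ₗ (range n) (λ j → χ (P? (i , j)))) ⟩
  ∑< (side n) (λ t → ∑ₗ (range n) (λ j → χ (P? (coord n t , j))))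
    ≡⟨ ∑<-cong (side n) (λ t _ → ∑ₗ-range n (λ j → χ (P? (coord n t , j)))) ⟩
  ∑□ n (λ q → χ (P? q)) ∎
  where open ≡-Reasoning

∑□-cong : ∀ n {f g : Point → ℤ} → (∀ p → f p ≡ g p) → ∑□ n f ≡ ∑□ n g
∑□-cong n h = ∑<-cong (side n) (λ t _ → ∑<-cong (side n) (λ u _ → h (coord n t , coord n u)))

∑□-+ : ∀ n f g → ∑□ n (λ p → f p + g p) ≡ ∑□ n f + ∑□ n g
∑□-+ n f g = trans (∑<-cong (side n) (λ t _ → ∑<-+ (side n) (row f t) (row g t)))
                   (∑<-+ (side n) (λ t → ∑< (side n) (row f t)) (λ t → ∑< (side n) (row g t)))
  where
  row : (Point → ℤ) → ℕ → ℕ → ℤ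
  row f t u = f (coord n t , coord n u)

∑□-− : ∀ n f g → ∑□ n (λ p → f p - g p) ≡ ∑□ n f - ∑□ n g
∑□-− n f g = trans (∑<-cong (side n) (λ t _ → ∑<-− (side n) (row f t) (row g t)))
                   (∑<-− (side n) (λ t → ∑< (side n) (row f t)) (λ t → ∑< (side n) (row g t)))
  where
  row : (Point → ℤ) → ℕ → ℕ → ℤ
  row f t u = f (coord n t , coord n u)

∑□-*ʳ : ∀ n f c → ∑□ n (λ p → f p * c) ≡ ∑□ n f * c
∑□-*ʳ n f c = trans (∑<-cong (side n) (λ t _ → ∑<-*ʳ (side n) (row t) c))
                    (∑<-*ʳ (side n) (λ t → ∑< (side n) (row t)) c)
  where
  row : ℕ → ℕ → ℤ
  row t u = f (coord n t , coord n u)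

∑□-+₄ : ∀ n f g h k → ∑□ n (λ p → f p + g p + h p + k p) ≡ ∑□ n f + ∑□ n g + ∑□ n h + ∑□ n k
∑□-+₄ n f g h k = begin
  ∑□ n (λ p → f p + g p + h p + k p)          ≡⟨ ∑□-+ n (λ p → f p + g p + h p) k ⟩
  ∑□ n (λ p → f p + g p + h p) + ∑□ n k       ≡⟨ cong (_+ ∑□ n k) (∑□-+ n (λ p → f p + g p) h) ⟩
  ∑□ n (λ p → f p + g p) + ∑□ n h + ∑□ n k    ≡⟨ cong (λ x → x + ∑□ n h + ∑□ n k) (∑□-+ n f g) ⟩
  ∑□ n f + ∑□ n g + ∑□ n h + ∑□ n k           ∎
  where open ≡-Reasoning

side-split : ∀ n → side n ≡ suc n ℕ.+ suc (suc n)
side-split n = cong suc (trans (cong (suc n ℕ.+_) (ℕP.+-identityʳ (suc n))) (sym (ℕP.+-suc n (suc n))))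

coord-suc : ∀ n t → coord n (suc t) ≡ coord n t + 1ℤ
coord-suc n t = trans (cong (λ w → + w - + suc n) (ℕP.+-comm 1 t)) (rearrange (+ t) (+ suc n))
  where
  rearrange : ∀ a b → a + 1ℤ - b ≡ a - b + 1ℤ
  rearrange = solve-∀

coord-side : ∀ n → coord n (side n) ≡ + suc (suc n)
coord-side n = begin
  + side n - + suc n                             ≡⟨ cong (λ w → + w - + suc n) (trans (side-split n) (ℕP.+-comm (suc n) _)) ⟩
  + (suc (suc n) ℕ.+ suc n) - + suc n            ≡⟨ cong (_- + suc n) (ℤP.pos-+ (suc (suc n)) (suc n)) ⟩
  + suc (suc n) + + suc n - + suc n              ≡⟨ cancel (+ suc (suc n)) (+ suc n) ⟩
  + suc (suc n)                                  ∎
  where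
  open ≡-Reasoning
  cancel : ∀ a b → a + b - b ≡ a
  cancel = solve-∀

-- Translating a one-dimensional box sum by one step; only the two far ends
-- -(n+1) and n+2 are affected.
∑<-coord-shift : ∀ n (h : ℤ → ℤ) → h -[1+ n ] ≡ 0ℤ → h (+ suc (suc n)) ≡ 0ℤ →
  ∑< (side n) (λ t → h (coord n t)) ≡ ∑< (side n) (λ t → h (coord n t + 1ℤ))
∑<-coord-shift n h left right =
  trans (∑<-shift (side n) (λ t → h (coord n t)) left (trans (cong h (coord-side n)) right))
        (∑<-cong (side n) (λ t _ → cong h (coord-suc n t)))

∑□-shiftˣ : ∀ n f → (∀ i j → suc n ≤ ∣ i ∣ → f (i , j) ≡ 0ℤ) →
  ∑□ n f ≡ ∑□ n (λ p → f (proj₁ p + 1ℤ , proj₂ p))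
∑□-shiftˣ n f vanish = ∑<-coord-shift n (λ i → ∑< (side n) (λ u → f (i , coord n u)))
  (∑<-zero (side n) _ (λ u _ → vanish -[1+ n ] (coord n u) ℕP.≤-refl))
  (∑<-zero (side n) _ (λ u _ → vanish (+ suc (suc n)) (coord n u) (ℕP.n≤1+n (suc n))))

∑□-shiftʸ : ∀ n f → (∀ i j → suc n ≤ ∣ j ∣ → f (i , j) ≡ 0ℤ) →
  ∑□ n f ≡ ∑□ n (λ p → f (proj₁ p , proj₂ p + 1ℤ))
∑□-shiftʸ n f vanish = ∑<-cong (side n) (λ t _ → ∑<-coord-shift n (λ j → f (coord n t , j))
  (vanish (coord n t) -[1+ n ] ℕP.≤-refl) (vanish (coord n t) (+ suc (suc n)) (ℕP.n≤1+n (suc n))))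

interior-vanishesˣ : ∀ n (G : Point → ℤ) i j → suc n ≤ ∣ i ∣ → interior n (i , j) * G (i , j) ≡ 0ℤ
interior-vanishesˣ n G i j big = trans (cong (_* G (i , j)) (χ-no (interiorNode? n (i , j)) outside))
                                       (ℤP.*-zeroˡ (G (i , j)))
  where
  outside : ¬ InteriorNode n (i , j)
  outside int = ℕP.<-irrefl refl
    (ℕP.≤-trans big (ℕP.≤-trans (ℕP.m≤m+n ∣ i ∣ ∣ j ∣) (interior⇒norm≤ n i j int)))

interior-vanishesʸ : ∀ n (G : Point → ℤ) i j → suc n ≤ ∣ j ∣ → interior n (i , j) * G (i , j) ≡ 0ℤ
interior-vanishesʸ n G i j big = trans (cong (_* G (i , j)) (χ-no (interiorNode? n (i , j)) outside))
                                       (ℤP.*-zeroˡ (G (i , j)))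
  where
  outside : ¬ InteriorNode n (i , j)
  outside int = ℕP.<-irrefl refl
    (ℕP.≤-trans big (ℕP.≤-trans (ℕP.m≤n+m ∣ j ∣ ∣ i ∣) (interior⇒norm≤ n i j int)))

nodeTerm : ℕ → Arrows → (Point → Square) → Point → ℤ
nodeTerm n F sq p = interior n p * flow n F (sq p) p

-- Each square (k , l) is the NE, SW, NW, SE
-- square of its corners (k , l), (k+1 , l+1), (k+1 , l), (k , l+1) respectively.
double-counting : ∀ n F →
  ∑□ n (λ p → interior n p * divergence n F p) ≡ ∑□ n (λ s → squareFlux n F (proj₁ s) (proj₂ s))
double-counting n F = begin
  ∑□ n (λ p → interior n p * divergence n F p)
    ≡⟨ ∑□-cong n (λ p → distrib (interior n p) (flow n F (sqNE p) p) (flow n F (sqSW p) p)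
                                               (flow n F (sqNW p) p) (flow n F (sqSE p) p)) ⟩
  ∑□ n (λ p → term sqNE p + term sqSW p + term sqNW p + term sqSE p)
    ≡⟨ ∑□-+₄ n (term sqNE) (term sqSW) (term sqNW) (term sqSE) ⟩
  ∑□ n (term sqNE) + ∑□ n (term sqSW) + ∑□ n (term sqNW) + ∑□ n (term sqSE)
    ≡⟨ cong₂ _+_ (cong₂ _+_ (cong (_+_ (∑□ n (term sqNE))) shift-SW) shift-NW) shift-SE ⟩
  ∑□ n (term sqNE) + ∑□ n (λ p → term sqSW (k p + 1ℤ , l p + 1ℤ))
    + ∑□ n (λ p → term sqNW (k p + 1ℤ , l p)) + ∑□ n (λ p → term sqSE (k p , l p + 1ℤ))
    ≡⟨ ∑□-+₄ n (term sqNE) (λ p → term sqSW (k p + 1ℤ , l p + 1ℤ))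
               (λ p → term sqNW (k p + 1ℤ , l p)) (λ p → term sqSE (k p , l p + 1ℤ)) ⟨
  ∑□ n (λ p → term sqNE p + term sqSW (k p + 1ℤ , l p + 1ℤ)
              + term sqNW (k p + 1ℤ , l p) + term sqSE (k p , l p + 1ℤ))
    ≡⟨ ∑□-cong n corners ⟩
  ∑□ n (λ s → squareFlux n F (proj₁ s) (proj₂ s)) ∎
  where
  open ≡-Reasoning
  k l : Point → ℤ
  k = proj₁
  l = proj₂
  term : (Point → Square) → Point → ℤ
  term = nodeTerm n F
  distrib : ∀ i a b c d → i * (a + b + c + d) ≡ i * a + i * b + i * c + i * d
  distrib = solve-∀
  back : ∀ x → x + 1ℤ - 1ℤ ≡ x
  back = solve-∀
  at : ∀ sq q {s} → sq q ≡ s → nodeTerm n F sq q ≡ interior n q * flow n F s q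
  at sq q e = cong (λ s → interior n q * flow n F s q) e
  corners : ∀ p → term sqNE p + term sqSW (k p + 1ℤ , l p + 1ℤ) + term sqNW (k p + 1ℤ , l p)
                    + term sqSE (k p , l p + 1ℤ) ≡ squareFlux n F (k p) (l p)
  corners (a , b) = cong₂ _+_ (cong₂ _+_
    (cong (_+_ (term sqNE (a , b))) (at sqSW (a + 1ℤ , b + 1ℤ) (cong₂ _,_ (back a) (back b))))
    (at sqNW (a + 1ℤ , b) (cong₂ _,_ (back a) refl)))
    (at sqSE (a , b + 1ℤ) (cong₂ _,_ refl (back b)))
  shift-SW : ∑□ n (term sqSW) ≡ ∑□ n (λ p → term sqSW (k p + 1ℤ , l p + 1ℤ))
  shift-SW = trans (∑□-shiftˣ n (term sqSW) (λ i j → interior-vanishesˣ n (λ q → flow n F (sqSW q) q) i j))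
                   (∑□-shiftʸ n (λ p → term sqSW (k p + 1ℤ , l p))
                      (λ i j → interior-vanishesʸ n (λ q → flow n F (sqSW q) q) (i + 1ℤ) j))
  shift-NW : ∑□ n (term sqNW) ≡ ∑□ n (λ p → term sqNW (k p + 1ℤ , l p))
  shift-NW = ∑□-shiftˣ n (term sqNW) (λ i j → interior-vanishesˣ n (λ q → flow n F (sqNW q) q) i j)
  shift-SE : ∑□ n (term sqSE) ≡ ∑□ n (λ p → term sqSE (k p , l p + 1ℤ))
  shift-SE = ∑□-shiftʸ n (term sqSE) (λ i j → interior-vanishesʸ n (λ q → flow n F (sqSE q) q) i j)

minAbs-coord-low : ∀ n t → t ℕ.< suc n → minAbs (coord n t) ≡ n ∸ t
minAbs-coord-low n t t<1+n = cong minAbs (begin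
  + t - + suc n                ≡⟨ ℤP.m-n≡m⊖n t (suc n) ⟩
  t ℤ.⊖ suc n                  ≡⟨ ℤP.⊖-< t<1+n ⟩
  ℤ.- + (suc n ∸ t)            ≡⟨ cong (λ w → ℤ.- + w) (ℕP.+-∸-assoc 1 (ℕP.≤-pred t<1+n)) ⟩
  -[1+ n ∸ t ]                 ∎)
  where open ≡-Reasoning

minAbs-coord-high : ∀ n u → minAbs (coord n (suc n ℕ.+ u)) ≡ u
minAbs-coord-high n u = cong minAbs (begin
  + (suc n ℕ.+ u) - + suc n    ≡⟨ ℤP.m-n≡m⊖n (suc n ℕ.+ u) (suc n) ⟩
  (suc n ℕ.+ u) ℤ.⊖ suc n      ≡⟨ ℤP.⊖-≥ (ℕP.m≤m+n (suc n) u) ⟩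
  + (suc n ℕ.+ u ∸ suc n)      ≡⟨ cong +_ (ℕP.m+n∸m≡n (suc n) u) ⟩
  + u                          ∎)
  where open ≡-Reasoning

-- Along one side of the box, minAbs takes the values n, n-1, …, 0 and then 0, 1, …, n+1.
∑<-minAbs-coord : ∀ n f → ∑< (side n) (λ t → f (minAbs (coord n t))) ≡ ∑< (suc n) f + ∑< (suc (suc n)) f
∑<-minAbs-coord n f = begin
  ∑< (side n) (λ t → f (minAbs (coord n t)))
    ≡⟨ cong (λ N → ∑< N (λ t → f (minAbs (coord n t)))) (side-split n) ⟩
  ∑< (suc n ℕ.+ suc (suc n)) (λ t → f (minAbs (coord n t)))
    ≡⟨ ∑<-split (suc n) (suc (suc n)) (λ t → f (minAbs (coord n t))) ⟩
  ∑< (suc n) (λ t → f (minAbs (coord n t))) + ∑< (suc (suc n)) (λ u → f (minAbs (coord n (suc n ℕ.+ u))))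
    ≡⟨ cong₂ _+_ (∑<-cong (suc n) (λ t t<1+n → cong f (minAbs-coord-low n t t<1+n)))
                 (∑<-cong (suc (suc n)) (λ u _ → cong f (minAbs-coord-high n u))) ⟩
  ∑< (suc n) (λ t → f (n ∸ t)) + ∑< (suc (suc n)) f
    ≡⟨ cong (_+ ∑< (suc (suc n)) f) (∑<-reverse n f) ⟩
  ∑< (suc n) f + ∑< (suc (suc n)) f ∎
  where open ≡-Reasoning

solutions : ∀ α n N → n ℕ.< N → ∑< N (λ u → χ (α ℕ.+ u ℕ.≟ n)) ≡ χ (α ℕ.≤? n)
solutions α n N n<N with α ℕ.≤? n
... | yes α≤n = ∑<-single N (n ∸ α) (λ u → χ (α ℕ.+ u ℕ.≟ n))
  (ℕP.≤-<-trans (ℕP.m∸n≤m n α) n<N) (χ-yes (α ℕ.+ (n ∸ α) ℕ.≟ n) (ℕP.m+[n∸m]≡n α≤n))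
  (λ u _ u≢n∸α → χ-no (α ℕ.+ u ℕ.≟ n) (λ e → u≢n∸α (trans (sym (ℕP.m+n∸m≡n α u)) (cong (_∸ α) e))))
... | no α≰n = ∑<-zero N (λ u → χ (α ℕ.+ u ℕ.≟ n))
  (λ u _ → χ-no (α ℕ.+ u ℕ.≟ n) (λ e → α≰n (subst (α ℕ.≤_) e (ℕP.m≤m+n α u))))

∑<-minAbs-≤ : ∀ n → ∑< (side n) (λ t → χ (minAbs (coord n t) ℕ.≤? n)) ≡ + suc n + + suc n
∑<-minAbs-≤ n = begin
  ∑< (side n) (λ t → χ (minAbs (coord n t) ℕ.≤? n))
    ≡⟨ ∑<-minAbs-coord n (λ u → χ (u ℕ.≤? n)) ⟩
  ∑< (suc n) (λ u → χ (u ℕ.≤? n)) + ∑< (suc (suc n)) (λ u → χ (u ℕ.≤? n))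
    ≡⟨ cong (_+_ (∑< (suc n) (λ u → χ (u ℕ.≤? n)))) (∑<-snoc (suc n) (λ u → χ (u ℕ.≤? n))) ⟩
  ∑< (suc n) (λ u → χ (u ℕ.≤? n)) + (∑< (suc n) (λ u → χ (u ℕ.≤? n)) + χ (suc n ℕ.≤? n))
    ≡⟨ cong₂ (λ a b → a + (a + b)) up-to-n (χ-no (suc n ℕ.≤? n) (ℕP.<-irrefl refl)) ⟩
  + suc n + (+ suc n + 0ℤ)
    ≡⟨ cong (_+_ (+ suc n)) (ℤP.+-identityʳ (+ suc n)) ⟩
  + suc n + + suc n ∎
  where
  open ≡-Reasoning
  up-to-n : ∑< (suc n) (λ u → χ (u ℕ.≤? n)) ≡ + suc n
  up-to-n = ∑<-one (suc n) (λ u → χ (u ℕ.≤? n)) (λ u u<1+n → χ-yes (u ℕ.≤? n) (ℕP.≤-pred u<1+n))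

boundary-count : ∀ n → ∑□ n (λ s → χ (minAbs (proj₁ s) ℕ.+ minAbs (proj₂ s) ℕ.≟ n)) ≡ + suc n * + 4
boundary-count n = begin
  ∑< (side n) (λ t → ∑< (side n) (λ u → χ (a t ℕ.+ a u ℕ.≟ n)))
    ≡⟨ ∑<-cong (side n) (λ t _ → row (a t)) ⟩
  ∑< (side n) (λ t → χ (a t ℕ.≤? n) + χ (a t ℕ.≤? n))
    ≡⟨ ∑<-+ (side n) (λ t → χ (a t ℕ.≤? n)) (λ t → χ (a t ℕ.≤? n)) ⟩
  ∑< (side n) (λ t → χ (a t ℕ.≤? n)) + ∑< (side n) (λ t → χ (a t ℕ.≤? n))
    ≡⟨ cong₂ _+_ (∑<-minAbs-≤ n) (∑<-minAbs-≤ n) ⟩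
  + suc n + + suc n + (+ suc n + + suc n)
    ≡⟨ four-times (+ suc n) ⟩
  + suc n * + 4 ∎
  where
  open ≡-Reasoning
  a : ℕ → ℕ
  a t = minAbs (coord n t)
  row : ∀ α → ∑< (side n) (λ u → χ (α ℕ.+ a u ℕ.≟ n)) ≡ χ (α ℕ.≤? n) + χ (α ℕ.≤? n)
  row α = trans (∑<-minAbs-coord n (λ w → χ (α ℕ.+ w ℕ.≟ n)))
                (cong₂ _+_ (solutions α n (suc n) ℕP.≤-refl) (solutions α n (suc (suc n)) (ℕP.n≤1+n (suc n))))
  four-times : ∀ x → x + x + (x + x) ≡ x * + 4
  four-times = solve-∀

lemma2 : (n : ℕ) → 1 ≤ n → (F : Arrows) → IsFieldOfArrows n F → OutwardPointing n F →
    + numRepelling n F - + numAttracting n F ≡ + suc n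
lemma2 n 1≤n F isField outward = ℤP.*-cancelʳ-≡ _ _ (+ 4) (begin
  (+ numRepelling n F - + numAttracting n F) * + 4
    ≡⟨ cong₂ (λ r a → (r - a) * + 4) (count-box rep? n) (count-box att? n) ⟩
  (∑□ n R - ∑□ n A) * + 4
    ≡⟨ distrib (∑□ n R) (∑□ n A) ⟩
  ∑□ n R * + 4 - ∑□ n A * + 4
    ≡⟨ cong₂ _-_ (∑□-*ʳ n R (+ 4)) (∑□-*ʳ n A (+ 4)) ⟨
  ∑□ n (λ p → R p * + 4) - ∑□ n (λ p → A p * + 4)
    ≡⟨ ∑□-− n (λ p → R p * + 4) (λ p → A p * + 4) ⟨
  ∑□ n (λ p → R p * + 4 - A p * + 4)
    ≡⟨ ∑□-cong n (weighted-node-balance n F isField) ⟩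
  ∑□ n (λ p → interior n p * divergence n F p)
    ≡⟨ double-counting n F ⟩
  ∑□ n (λ s → squareFlux n F (proj₁ s) (proj₂ s))
    ≡⟨ ∑□-cong n (λ s → squareFlux-boundary n 1≤n F outward (proj₁ s) (proj₂ s)) ⟩
  ∑□ n (λ s → χ (minAbs (proj₁ s) ℕ.+ minAbs (proj₂ s) ℕ.≟ n))
    ≡⟨ boundary-count n ⟩
  + suc n * + 4 ∎)
  where
  open ≡-Reasoning
  rep? : (p : Point) → Dec (InteriorNode n p × Repelling n F p)
  att? : (p : Point) → Dec (InteriorNode n p × Attracting n F p)
  rep? p = interiorNode? n p ×-dec repelling? n F p
  att? p = interiorNode? n p ×-dec attracting? n F p
  R A : Point → ℤ
  R p = χ (rep? p)
  A p = χ (att? p)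
  distrib : ∀ x y → (x - y) * + 4 ≡ x * + 4 - y * + 4
  distrib = solve-∀
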